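{- Let $p,q$ be complex numbers with $p\neq0$, $q\neq0$, $p^2-4q\neq0$, and let $(u_n),(v_n),(w_n)$ be as in the context. Let $r,k,s$ be integers and $z$ a complex number with $q^r z^2 - v_r z + 1\neq 0$. Then \[ \sum_{j = 0}^k u_{rj + s}z^j = \frac{q^r u_{rk + s} z^{k + 2} - u_{rk + r + s} z^{k + 1} + q^s u_{r - s}z + u_s }{q^r z^2 - v_r z + 1}\,, \] \[ \sum_{j = 0}^k v_{rj + s} z^j = \frac{q^r v_{rk + s} z^{k + 2} - v_{rk + r + s} z^{k + 1} - q^s v_{r-s}z + v_s }{q^r z^2 - v_r z + 1}\,, \] \[ \sum_{j = 0}^k w_{rj + s} z^j = \frac{q^r w_{rk + s} z^{k + 2} - w_{rk + r + s} z^{k + 1} - q^rw_{s-r}z + w_s }{q^r z^2 - v_r z + 1}\,. \]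
   Context: For complex numbers $a,b,p,q$ with $p\neq0,q\neq0$, the Horadam sequence $(w_n)=(w_n(a,b;p,q))$ is defined by $w_0=a$, $w_1=b$, $w_n=pw_{n-1}-qw_{n-2}$, extended to all integers $n$ by running the recurrence backwards. The Lucas sequences are $u_n=w_n(0,1;p,q)$ and $v_n=w_n(2,p;p,q)$. Let $\alpha,\beta$ be the (distinct, since $p^2-4q\neq0$) roots of $x^2-px+q$, so $\alpha+\beta=p$, $\alpha\beta=q$; then $u_n=(\alpha^n-\beta^n)/(\alpha-\beta)$, $v_n=\alpha^n+\beta^n$ for all integers $n$. -}

module Defs where

open import Level using (Level; _⊔_) renaming (suc to lsuc)
open import Algebra.Bundles using (CommutativeRing)
open import Relation.Nullary using (¬_)
open import Data.Nat using (ℕ; zero; suc)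
open import Data.Integer using (ℤ; +_; -[1+_])
open import Data.Product using (_×_; _,_; proj₁; proj₂)

record Field (c ℓ : Level) : Set (lsuc (c ⊔ ℓ)) where
  field
    commutativeRing : CommutativeRing c ℓ
  open CommutativeRing commutativeRing public
  field
    inv     : (x : Carrier) → ¬ (x ≈ 0#) → Carrier
    inverse : (x : Carrier) (nz : ¬ (x ≈ 0#)) → (x * inv x nz) ≈ 1#
    0≉1     : ¬ (0# ≈ 1#)

module FieldOps {c ℓ : Level} (F : Field c ℓ) where
  open Field F using (Carrier; _≈_; _+_; _*_; _-_; 0#; 1#; inv)

  _^_ : Carrier → ℕ → Carrier
  x ^ zero  = 1#
  x ^ suc n = x * (x ^ n)

  zpow : (x : Carrier) → ¬ (x ≈ 0#) → ℤ → Carrier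
  zpow x nz (+ n)      = x ^ n
  zpow x nz -[1+ n ]   = inv x nz ^ suc n

  sumTo : ℕ → (ℕ → Carrier) → Carrier
  sumTo zero    f = f zero
  sumTo (suc k) f = sumTo k f + f (suc k)

  module Horadam (a b p q : Carrier) (q≉0 : ¬ (q ≈ 0#)) where
    fwd : ℕ → Carrier × Carrier
    fwd zero    = a , b
    fwd (suc n) = proj₂ (fwd n) , (p * proj₂ (fwd n) - q * proj₁ (fwd n))

    -- backward pairs (w_{-n} , w_{-n+1}) for n ≥ 0, using
    -- w_{m-2} = (p w_{m-1} - w_m) / q
    bwd : ℕ → Carrier × Carrier
    bwd zero    = a , b
    bwd (suc n) = ((p * proj₁ (bwd n) - proj₂ (bwd n)) * inv q q≉0) , proj₁ (bwd n)

    w : ℤ → Carrier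
    w (+ n)      = proj₁ (fwd n)
    w -[1+ n ]   = proj₁ (bwd (suc n))

  horadam : (a b p q : Carrier) → ¬ (q ≈ 0#) → ℤ → Carrier
  horadam a b p q q≉0 = Horadam.w a b p q q≉0

  lucasU : (p q : Carrier) → ¬ (q ≈ 0#) → ℤ → Carrier
  lucasU p q q≉0 = horadam 0# 1# p q q≉0

  lucasV : (p q : Carrier) → ¬ (q ≈ 0#) → ℤ → Carrier
  lucasV p q q≉0 = horadam (1# + 1#) p p q q≉0

-- Every sequence in sight satisfies f (n + 2) = p f (n + 1) − q f n on all of ℤ, and since q ≠ 0
-- such a solution is determined by f 0 and f 1. So identities between solutions need only be
-- checked at n = 0, 1; this gives v_r f_m = f_{m+r} + q^r f_{m−r}, whence j ↦ f_{rj+s} solves the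
-- recurrence with coefficients v_r and q^r, as well as the reflection formulas
-- q^s u_{r−s} = −q^r u_{s−r} and q^s v_{r−s} = q^r v_{s−r}. For any solution a of a recurrence with
-- coefficients c, d, multiplying Σ_{j≤k} a_j z^j by d z² − c z + 1 telescopes to
-- d a_k z^{k+2} − a_{k+1} z^{k+1} − d a_{−1} z + a_0.
module Submission where

open import Defs
open import Level using (Level)
open import Relation.Nullary using (¬_)
open import Data.Nat using (ℕ; suc)
open import Data.Integer using (ℤ; +_) renaming (_+_ to _+ℤ_; _*_ to _*ℤ_; _-_ to _-ℤ_)
open import Data.Product using (_×_)

open import Algebra.Bundles using (CommutativeRing)
open import Algebra.Solver.Ring.AlmostCommutativeRing
  using (fromCommutativeRing; _-Raw-AlmostCommutative⟶_)
open import Data.Integer as ℤ using (-[1+_]; _⊖_; _◃_)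
import Data.Integer.Properties as ℤ
open import Data.Integer.Tactic.RingSolver using (solve-∀)
open import Data.Maybe using (Maybe; nothing; just)
open import Data.Nat using (zero) renaming (_+_ to _+ℕ_; _*_ to _*ℕ_)
import Data.Nat.Properties as ℕ
open import Data.Product using (_,_; proj₁)
import Data.Sign as Sign
open import Relation.Binary.PropositionalEquality as ≡ using (_≡_; cong)
open import Relation.Nullary using (yes; no)

module IntegerCoefficients {c ℓ : Level} (R : CommutativeRing c ℓ) where
  open CommutativeRing R
  open import Algebra.Properties.Ring ring
  open import Algebra.Properties.Semiring.Mult.TCOptimised semiring
    using (1+×; ×-homo-+; ×1-homo-*) renaming (_×_ to _·_)
  open import Relation.Binary.Reasoning.Setoid setoid

  -- The optimised multiple makes ι (+ 1) definitionally 1#, so that the solver's con (+ 1) is 1#.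
  ι : ℤ → Carrier
  ι (+ n)    = n · 1#
  ι -[1+ n ] = - (suc n · 1#)

  ι-neg : ∀ i → ι (ℤ.- i) ≈ - ι i
  ι-neg (+ zero)  = sym -0#≈0#
  ι-neg (+ suc n) = refl
  ι-neg -[1+ n ]  = sym (-‿involutive _)

  ι-⊖ : ∀ m n → ι (m ⊖ n) ≈ m · 1# - n · 1#
  ι-⊖ zero    zero    = sym (-‿inverseʳ 0#)
  ι-⊖ (suc m) zero    = sym (trans (+-congˡ -0#≈0#) (+-identityʳ _))
  ι-⊖ zero    (suc n) = sym (+-identityˡ _)
  ι-⊖ (suc m) (suc n) = begin
    ι (suc m ⊖ suc n)              ≡⟨ cong ι (ℤ.[1+m]⊖[1+n]≡m⊖n m n) ⟩
    ι (m ⊖ n)                      ≈⟨ ι-⊖ m n ⟩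
    a - b                          ≈⟨ xyx⁻¹≈y 1# (a - b) ⟨
    1# + (a - b) - 1#              ≈⟨ +-congʳ (+-assoc 1# a (- b)) ⟨
    1# + a - b - 1#                ≈⟨ +-assoc (1# + a) (- b) (- 1#) ⟩
    1# + a + (- b - 1#)            ≈⟨ +-congˡ (-‿anti-homo-+ 1# b) ⟨
    1# + a - (1# + b)              ≈⟨ +-cong (1+× m 1#) (-‿cong (1+× n 1#)) ⟨
    suc m · 1# - suc n · 1#        ∎
    where
    a b : Carrier
    a = m · 1#
    b = n · 1#

  ι-+ : ∀ i j → ι (i ℤ.+ j) ≈ ι i + ι j
  ι-+ (+ m)    (+ n)    = ×-homo-+ 1# m n
  ι-+ (+ m)    -[1+ n ] = ι-⊖ m (suc n)
  ι-+ -[1+ m ] (+ n)    = trans (ι-⊖ n (suc m)) (+-comm _ _)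
  ι-+ -[1+ m ] -[1+ n ] = begin
    - (suc (suc (m +ℕ n)) · 1#)      ≡⟨ cong (λ k → - (k · 1#)) (ℕ.+-suc (suc m) n) ⟨
    - ((suc m +ℕ suc n) · 1#)        ≈⟨ -‿cong (×-homo-+ 1# (suc m) (suc n)) ⟩
    - (suc m · 1# + suc n · 1#)      ≈⟨ -‿+-comm _ _ ⟨
    - (suc m · 1#) + - (suc n · 1#)  ∎

  ι-+◃ : ∀ n → ι (Sign.+ ◃ n) ≈ n · 1#
  ι-+◃ zero    = refl
  ι-+◃ (suc n) = refl

  ι--◃ : ∀ n → ι (Sign.- ◃ n) ≈ - (n · 1#)
  ι--◃ zero    = sym -0#≈0#
  ι--◃ (suc n) = refl

  ι-* : ∀ i j → ι (i ℤ.* j) ≈ ι i * ι j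
  ι-* (+ m)    (+ n)    = trans (ι-+◃ (m *ℕ n)) (×1-homo-* m n)
  ι-* (+ m)    -[1+ n ] = begin
    ι (Sign.- ◃ (m *ℕ suc n))  ≈⟨ ι--◃ (m *ℕ suc n) ⟩
    - ((m *ℕ suc n) · 1#)      ≈⟨ -‿cong (×1-homo-* m (suc n)) ⟩
    - (m · 1# * suc n · 1#)    ≈⟨ -‿distribʳ-* _ _ ⟩
    m · 1# * - (suc n · 1#)    ∎
  ι-* -[1+ m ] (+ n)    = begin
    ι (Sign.- ◃ (suc m *ℕ n))  ≈⟨ ι--◃ (suc m *ℕ n) ⟩
    - ((suc m *ℕ n) · 1#)      ≈⟨ -‿cong (×1-homo-* (suc m) n) ⟩
    - (suc m · 1# * n · 1#)    ≈⟨ -‿distribˡ-* _ _ ⟩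
    - (suc m · 1#) * n · 1#    ∎
  ι-* -[1+ m ] -[1+ n ] = begin
    (suc m *ℕ suc n) · 1#            ≈⟨ ×1-homo-* (suc m) (suc n) ⟩
    suc m · 1# * suc n · 1#          ≈⟨ -‿involutive _ ⟨
    - - (suc m · 1# * suc n · 1#)    ≈⟨ -‿cong (-‿distribˡ-* _ _) ⟩
    - (- (suc m · 1#) * suc n · 1#)  ≈⟨ -‿distribʳ-* _ _ ⟩
    - (suc m · 1#) * - (suc n · 1#)  ∎

  ι-homomorphism : ℤ.+-*-rawRing -Raw-AlmostCommutative⟶ fromCommutativeRing R
  ι-homomorphism = record
    { ⟦_⟧ = ι ; +-homo = ι-+ ; *-homo = ι-* ; -‿homo = ι-neg ; 0-homo = refl ; 1-homo = refl }

  ι-≟ : ∀ i j → Maybe (ι i ≈ ι j)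
  ι-≟ i j with i ℤ.≟ j
  ... | yes i≡j = just (reflexive (cong ι i≡j))
  ... | no _    = nothing

  open import Algebra.Solver.Ring ℤ.+-*-rawRing (fromCommutativeRing R) ι-homomorphism ι-≟ public

suc[c-suc[n]]≡c-n : ∀ c n → + 1 +ℤ (c -ℤ (+ 1 +ℤ n)) ≡ c -ℤ n
suc[c-suc[n]]≡c-n = solve-∀

module LinearRecurrences {c ℓ : Level} (F : Field c ℓ) where
  open Field F
  open FieldOps F
  open IntegerCoefficients commutativeRing
  open import Relation.Binary.Reasoning.Setoid setoid

  -- Stated with ℤ.suc, so that the indices reduce on + k and on -[1+ k ].
  Recurrent : Carrier → Carrier → (ℤ → Carrier) → Set ℓ
  Recurrent p q f = ∀ n → f (ℤ.suc (ℤ.suc n)) ≈ p * f (ℤ.suc n) - q * f n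

  x*y≈z⇒x≈z*y⁻¹ : ∀ {x y z} → x * y ≈ z → (y≉0 : ¬ (y ≈ 0#)) → x ≈ z * inv y y≉0
  x*y≈z⇒x≈z*y⁻¹ {x} {y} {z} xy≈z y≉0 = begin
    x                    ≈⟨ *-identityʳ x ⟨
    x * 1#               ≈⟨ *-congˡ (inverse y y≉0) ⟨
    x * (y * inv y y≉0)  ≈⟨ *-assoc x y _ ⟨
    x * y * inv y y≉0    ≈⟨ *-congʳ xy≈z ⟩
    z * inv y y≉0        ∎

  generating-sum : ∀ {p q a} → Recurrent p q a → ∀ k z →
    sumTo k (λ j → a (+ j) * z ^ j) * (q * z ^ 2 - p * z + 1#)
      ≈ q * a (+ k) * z ^ suc (suc k) - a (+ suc k) * z ^ suc k - q * a -[1+ 0 ] * z + a (+ 0)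
  generating-sum {p} {q} {a} rec zero z = begin
    a₀ * 1# * (q * (z * (z * 1#)) - p * z + 1#)
      ≈⟨ solve 5 (λ p q a₋₁ a₀ z →
           a₀ :* con (+ 1) :* (q :* (z :* (z :* con (+ 1))) :- p :* z :+ con (+ 1))
           := q :* a₀ :* (z :* (z :* con (+ 1))) :- (p :* a₀ :- q :* a₋₁) :* (z :* con (+ 1))
              :- q :* a₋₁ :* z :+ a₀) refl p q a₋₁ a₀ z ⟩
    q * a₀ * z ^ 2 - (p * a₀ - q * a₋₁) * z ^ 1 - q * a₋₁ * z + a₀
      ≈⟨ +-congʳ (+-congʳ (+-congˡ (-‿cong (*-congʳ (rec -[1+ 0 ]))))) ⟨
    q * a₀ * z ^ 2 - a (+ 1) * z ^ 1 - q * a₋₁ * z + a₀ ∎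
    where
    a₋₁ a₀ : Carrier
    a₋₁ = a -[1+ 0 ]
    a₀  = a (+ 0)
  generating-sum {p} {q} {a} rec (suc k) z = begin
    (sumTo k T + T (suc k)) * D                   ≈⟨ distribʳ D _ _ ⟩
    sumTo k T * D + T (suc k) * D                 ≈⟨ +-congʳ (generating-sum rec k z) ⟩
    q * aₖ * (z * P) - a′ * P - E + a₀ + T (suc k) * D
      ≈⟨ solve 8 (λ p q aₖ a′ a₀ P z E →
           q :* aₖ :* (z :* P) :- a′ :* P :- E :+ a₀
             :+ a′ :* P :* (q :* (z :* (z :* con (+ 1))) :- p :* z :+ con (+ 1))
           := q :* a′ :* (z :* (z :* P)) :- (p :* a′ :- q :* aₖ) :* (z :* P) :- E :+ a₀)
           refl p q aₖ a′ a₀ P z E ⟩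
    q * a′ * (z * (z * P)) - (p * a′ - q * aₖ) * (z * P) - E + a₀
      ≈⟨ +-congʳ (+-congʳ (+-congˡ (-‿cong (*-congʳ (rec (+ k)))))) ⟨
    q * a′ * (z * (z * P)) - a (+ suc (suc k)) * (z * P) - E + a₀ ∎
    where
    T : ℕ → Carrier
    T j = a (+ j) * z ^ j
    D aₖ a′ a₀ P E : Carrier
    D  = q * z ^ 2 - p * z + 1#
    aₖ = a (+ k)
    a′ = a (+ suc k)
    a₀ = a (+ 0)
    P  = z ^ suc k
    E  = q * a -[1+ 0 ] * z

  module Recurrence (p q : Carrier) (q≉0 : ¬ (q ≈ 0#)) where
    private
      Z : ℤ → Carrier
      Z = zpow q q≉0
      q⁻¹ : Carrier
      q⁻¹ = inv q q≉0
      U V : ℤ → Carrier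
      U = lucasU p q q≉0
      V = lucasV p q q≉0

    zpow-suc : ∀ n → Z (ℤ.suc n) ≈ q * Z n
    zpow-suc (+ n)        = refl
    zpow-suc -[1+ zero ]  = sym (trans (*-congˡ (*-identityʳ q⁻¹)) (inverse q q≉0))
    zpow-suc -[1+ suc n ] = begin
      q⁻¹ ^ suc n                ≈⟨ *-identityˡ _ ⟨
      1# * q⁻¹ ^ suc n           ≈⟨ *-congʳ (inverse q q≉0) ⟨
      q * q⁻¹ * q⁻¹ ^ suc n      ≈⟨ *-assoc q q⁻¹ _ ⟩
      q * (q⁻¹ * q⁻¹ ^ suc n)    ∎

    recurrent-step : ∀ {f} → Recurrent p q f → ∀ {m n} → ℤ.suc n ≡ m →
      f (ℤ.suc m) ≈ p * f m - q * f n
    recurrent-step rec {n = n} ≡.refl = rec n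

    recurrent-backward : ∀ {f} → Recurrent p q f → ∀ n →
      f n ≈ (p * f (ℤ.suc n) - f (ℤ.suc (ℤ.suc n))) * q⁻¹
    recurrent-backward {f} rec n = begin
      f n                                        ≈⟨ x*y≈z⇒x≈z*y⁻¹ (*-comm (f n) q) q≉0 ⟩
      q * f n * q⁻¹                              ≈⟨ *-congʳ (solve 4 (λ p q x y →
                                                      q :* y := p :* x :- (p :* x :- q :* y)) refl p q _ _) ⟩
      (p * f₁ - (p * f₁ - q * f n)) * q⁻¹        ≈⟨ *-congʳ (+-congˡ (-‿cong (rec n))) ⟨
      (p * f₁ - f (ℤ.suc (ℤ.suc n))) * q⁻¹       ∎
      where
      f₁ : Carrier
      f₁ = f (ℤ.suc n)

    recurrent-unique : ∀ {f g} → Recurrent p q f → Recurrent p q g →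
      f (+ 0) ≈ g (+ 0) → f (+ 1) ≈ g (+ 1) → ∀ n → f n ≈ g n
    recurrent-unique {f} {g} recf recg f₀≈g₀ f₁≈g₁ = agree
      where
      forward : ∀ {n} → f n ≈ g n → f (ℤ.suc n) ≈ g (ℤ.suc n) →
                f (ℤ.suc (ℤ.suc n)) ≈ g (ℤ.suc (ℤ.suc n))
      forward {n} eq eq′ = trans (recf n) (trans (+-cong (*-congˡ eq′) (-‿cong (*-congˡ eq))) (sym (recg n)))

      backward : ∀ {n} → f (ℤ.suc n) ≈ g (ℤ.suc n) → f (ℤ.suc (ℤ.suc n)) ≈ g (ℤ.suc (ℤ.suc n)) →
                 f n ≈ g n
      backward {n} eq eq′ = trans (recurrent-backward recf n)
        (trans (*-congʳ (+-cong (*-congˡ eq) (-‿cong eq′))) (sym (recurrent-backward recg n)))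

      nonnegative : ∀ k → f (+ k) ≈ g (+ k) × f (+ suc k) ≈ g (+ suc k)
      nonnegative zero    = f₀≈g₀ , f₁≈g₁
      nonnegative (suc k) = let eq , eq′ = nonnegative k in eq′ , forward eq eq′

      negative : ∀ k → f -[1+ k ] ≈ g -[1+ k ] × f (ℤ.suc -[1+ k ]) ≈ g (ℤ.suc -[1+ k ])
      negative zero    = backward f₀≈g₀ f₁≈g₁ , f₀≈g₀
      negative (suc k) = let eq , eq′ = negative k in backward eq eq′ , eq

      agree : ∀ n → f n ≈ g n
      agree (+ k)    = proj₁ (nonnegative k)
      agree -[1+ k ] = proj₁ (negative k)

    recurrent-+ : ∀ {f g} → Recurrent p q f → Recurrent p q g → Recurrent p q (λ n → f n + g n)
    recurrent-+ recf recg n = trans (+-cong (recf n) (recg n))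
      (solve 6 (λ p q x y x′ y′ →
        p :* x :- q :* y :+ (p :* x′ :- q :* y′) := p :* (x :+ x′) :- q :* (y :+ y′)) refl p q _ _ _ _)

    recurrent-*ˡ : ∀ {f} → Recurrent p q f → ∀ a → Recurrent p q (λ n → a * f n)
    recurrent-*ˡ rec a n = trans (*-congˡ (rec n))
      (solve 5 (λ a p q x y → a :* (p :* x :- q :* y) := p :* (a :* x) :- q :* (a :* y)) refl a p q _ _)

    recurrent-*ʳ : ∀ {f} → Recurrent p q f → ∀ a → Recurrent p q (λ n → f n * a)
    recurrent-*ʳ rec a n = trans (*-congʳ (rec n))
      (solve 5 (λ a p q x y → (p :* x :- q :* y) :* a := p :* (x :* a) :- q :* (y :* a)) refl a p q _ _)

    recurrent-shift : ∀ {f} → Recurrent p q f → ∀ c → Recurrent p q (λ n → f (n +ℤ c))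
    recurrent-shift {f} rec c n = trans (reflexive (cong f (ℤ.+-assoc (+ 1) (ℤ.suc n) c)))
      (recurrent-step rec (≡.sym (ℤ.+-assoc (+ 1) n c)))

    recurrent-reflect : ∀ {f} → Recurrent p q f → ∀ c → Recurrent p q (λ n → Z n * f (c -ℤ n))
    recurrent-reflect {f} rec c n = begin
      Z (ℤ.suc (ℤ.suc n)) * A
        ≈⟨ *-congʳ (trans (zpow-suc (ℤ.suc n)) (*-congˡ (zpow-suc n))) ⟩
      q * (q * W) * A
        ≈⟨ solve 5 (λ p q W A B →
             q :* (q :* W) :* A := p :* (q :* W :* B) :- q :* (W :* (p :* B :- q :* A))) refl p q W A B ⟩
      p * (q * W * B) - q * (W * (p * B - q * A))
        ≈⟨ +-congˡ (-‿cong (*-congˡ (*-congˡ C≈pB-qA))) ⟨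
      p * (q * W * B) - q * (W * C)
        ≈⟨ +-congʳ (*-congˡ (*-congʳ (zpow-suc n))) ⟨
      p * (Z (ℤ.suc n) * B) - q * (W * C) ∎
      where
      W A B C : Carrier
      W = Z n
      A = f (c -ℤ ℤ.suc (ℤ.suc n))
      B = f (c -ℤ ℤ.suc n)
      C = f (c -ℤ n)
      C≈pB-qA : C ≈ p * B - q * A
      C≈pB-qA = trans (reflexive (cong f (≡.sym (suc[c-suc[n]]≡c-n c n))))
        (recurrent-step rec (suc[c-suc[n]]≡c-n c (ℤ.suc n)))

    forward-of-backward : ∀ x y → y ≈ p * x - q * ((p * x - y) * q⁻¹)
    forward-of-backward x y = sym (begin
      p * x - q * ((p * x - y) * q⁻¹)   ≈⟨ +-congˡ (-‿cong (solve 3 (λ q z i →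
                                              q :* (z :* i) := z :* (q :* i)) refl q _ q⁻¹)) ⟩
      p * x - (p * x - y) * (q * q⁻¹)   ≈⟨ +-congˡ (-‿cong (*-congˡ (inverse q q≉0))) ⟩
      p * x - (p * x - y) * 1#          ≈⟨ solve 3 (λ p x y → p :* x :- (p :* x :- y) :* con (+ 1) := y) refl p x y ⟩
      y                                 ∎)

    horadam-recurrent : ∀ a b → Recurrent p q (horadam a b p q q≉0)
    horadam-recurrent a b (+ n)              = refl
    horadam-recurrent a b -[1+ 0 ]           = forward-of-backward _ _
    horadam-recurrent a b -[1+ 1 ]           = forward-of-backward _ _
    horadam-recurrent a b -[1+ suc (suc n) ] = forward-of-backward _ _

    recurrent-at-−1 : ∀ {f} → Recurrent p q f → q * f -[1+ 0 ] ≈ p * f (+ 0) - f (+ 1)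
    recurrent-at-−1 rec = trans
      (solve 4 (λ p q x y → q :* y := p :* x :- (p :* x :- q :* y)) refl p q _ _)
      (+-congˡ (-‿cong (sym (rec -[1+ 0 ]))))

    lucasU-recurrent : Recurrent p q U
    lucasU-recurrent = horadam-recurrent 0# 1#

    lucasV-recurrent : Recurrent p q V
    lucasV-recurrent = horadam-recurrent (1# + 1#) p

    lucasV-* : ∀ {f} → Recurrent p q f → ∀ r m → V r * f m ≈ f (r +ℤ m) + Z r * f (m -ℤ r)
    lucasV-* {f} rec r m = recurrent-unique
      (recurrent-*ʳ lucasV-recurrent (f m))
      (recurrent-+ (recurrent-shift rec m) (recurrent-reflect rec m))
      at-0 at-1 r
      where
      at-0 : (1# + 1#) * f m ≈ f (+ 0 +ℤ m) + 1# * f (m -ℤ + 0)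
      at-0 = begin
        (1# + 1#) * f m   ≈⟨ solve 1 (λ x → con (+ 2) :* x := x :+ con (+ 1) :* x) refl (f m) ⟩
        f m + 1# * f m    ≈⟨ +-cong (reflexive (cong f (≡.sym (ℤ.+-identityˡ m))))
                                    (*-congˡ (reflexive (cong f (≡.sym (ℤ.+-identityʳ m))))) ⟩
        f (+ 0 +ℤ m) + 1# * f (m -ℤ + 0) ∎
      at-1 : p * f m ≈ f (ℤ.suc m) + q * 1# * f (m -ℤ + 1)
      at-1 = begin
        p * f m
          ≈⟨ solve 4 (λ p q x y → p :* x := p :* x :- q :* y :+ q :* con (+ 1) :* y) refl p q (f m) _ ⟩
        p * f m - q * f (m -ℤ + 1) + q * 1# * f (m -ℤ + 1)
          ≈⟨ +-congʳ (recurrent-step rec (≡.trans (suc[c-suc[n]]≡c-n m (+ 0)) (ℤ.+-identityʳ m))) ⟨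
        f (ℤ.suc m) + q * 1# * f (m -ℤ + 1) ∎

    recurrent-subsequence : ∀ {f} → Recurrent p q f → ∀ r s →
      Recurrent (V r) (Z r) (λ j → f (r *ℤ j +ℤ s))
    recurrent-subsequence {f} rec r s j = begin
      f (r *ℤ ℤ.suc (ℤ.suc j) +ℤ s)
        ≡⟨ cong f (r+[r*suc[j]+s]≡r*suc[suc[j]]+s r s j) ⟨
      f (r +ℤ m)
        ≈⟨ solve 2 (λ x y → x := x :+ y :- y) refl _ _ ⟩
      f (r +ℤ m) + Z r * f (m -ℤ r) - Z r * f (m -ℤ r)
        ≈⟨ +-congʳ (lucasV-* rec r m) ⟨
      V r * f m - Z r * f (m -ℤ r)
        ≡⟨ cong (λ i → V r * f m - Z r * f i) (r*suc[j]+s-r≡r*j+s r s j) ⟩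
      V r * f m - Z r * f (r *ℤ j +ℤ s) ∎
      where
      m : ℤ
      m = r *ℤ ℤ.suc j +ℤ s
      r+[r*suc[j]+s]≡r*suc[suc[j]]+s : ∀ r s j →
        r +ℤ (r *ℤ (+ 1 +ℤ j) +ℤ s) ≡ r *ℤ (+ 1 +ℤ (+ 1 +ℤ j)) +ℤ s
      r+[r*suc[j]+s]≡r*suc[suc[j]]+s = solve-∀
      r*suc[j]+s-r≡r*j+s : ∀ r s j → r *ℤ (+ 1 +ℤ j) +ℤ s -ℤ r ≡ r *ℤ j +ℤ s
      r*suc[j]+s-r≡r*j+s = solve-∀

    reflection-symmetry : ∀ {f} → Recurrent p q f → ∀ {ε} → ε * ε ≈ 1# →
      f (+ 0) ≈ ε * f (+ 0) → q * f -[1+ 0 ] ≈ ε * f (+ 1) →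
      ∀ r s → Z s * f (r -ℤ s) ≈ ε * (Z r * f (s -ℤ r))
    reflection-symmetry {f} rec {ε} ε²≈1 f₀≈εf₀ qf₋₁≈εf₁ r = recurrent-unique
      (recurrent-reflect rec r)
      (recurrent-*ˡ (recurrent-*ˡ (recurrent-shift rec (ℤ.- r)) (Z r)) ε)
      (trans (*-identityˡ _) (trans (reflexive (cong f (ℤ.+-identityʳ r))) (at-0 r)))
      (at-1 r)
      where
      at-0 : ∀ r → f r ≈ ε * (Z r * f (+ 0 -ℤ r))
      at-0 = recurrent-unique rec (recurrent-*ˡ (recurrent-reflect rec (+ 0)) ε)
        (trans f₀≈εf₀ (*-congˡ (sym (*-identityˡ _))))
        (begin
          f (+ 1)                      ≈⟨ *-identityˡ _ ⟨
          1# * f (+ 1)                 ≈⟨ *-congʳ ε²≈1 ⟨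
          ε * ε * f (+ 1)              ≈⟨ *-assoc ε ε _ ⟩
          ε * (ε * f (+ 1))            ≈⟨ *-congˡ qf₋₁≈εf₁ ⟨
          ε * (q * f -[1+ 0 ])         ≈⟨ *-congˡ (*-congʳ (*-identityʳ q)) ⟨
          ε * (q * 1# * f -[1+ 0 ])    ∎)

      at-1 : ∀ r → q * 1# * f (r -ℤ + 1) ≈ ε * (Z r * f (+ 1 -ℤ r))
      at-1 = recurrent-unique (recurrent-*ˡ (recurrent-shift rec -[1+ 0 ]) (q * 1#))
        (recurrent-*ˡ (recurrent-reflect rec (+ 1)) ε)
        (trans (*-congʳ (*-identityʳ q)) (trans qf₋₁≈εf₁ (*-congˡ (sym (*-identityˡ _)))))
        (trans (*-congˡ f₀≈εf₀) (solve 3 (λ a e x → a :* (e :* x) := e :* (a :* x)) refl _ ε _))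

    lucasU-reflection : ∀ r s → Z s * U (r -ℤ s) ≈ - (Z r * U (s -ℤ r))
    lucasU-reflection r s = trans
      (reflection-symmetry lucasU-recurrent
        (solve 0 ((:- con (+ 1)) :* (:- con (+ 1)) := con (+ 1)) refl)
        (solve 0 (con (+ 0) := (:- con (+ 1)) :* con (+ 0)) refl)
        (trans (recurrent-at-−1 lucasU-recurrent)
               (solve 1 (λ p → p :* con (+ 0) :- con (+ 1) := (:- con (+ 1)) :* con (+ 1)) refl p))
        r s)
      (solve 1 (λ x → (:- con (+ 1)) :* x := :- x) refl _)

    lucasV-reflection : ∀ r s → Z s * V (r -ℤ s) ≈ Z r * V (s -ℤ r)
    lucasV-reflection r s = trans
      (reflection-symmetry lucasV-recurrent (*-identityˡ 1#) (sym (*-identityˡ _))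
        (trans (recurrent-at-−1 lucasV-recurrent)
               (solve 1 (λ p → p :* con (+ 2) :- p := con (+ 1) :* p) refl p))
        r s)
      (*-identityˡ _)

    horadam-sum : ∀ {f} → Recurrent p q f → ∀ r s k z →
      (D≉0 : ¬ ((Z r * z ^ 2 - V r * z + 1#) ≈ 0#)) →
      sumTo k (λ j → f (r *ℤ + j +ℤ s) * z ^ j)
        ≈ (Z r * f (r *ℤ + k +ℤ s) * z ^ (k +ℕ 2) - f (r *ℤ + k +ℤ r +ℤ s) * z ^ suc k
            - Z r * f (s -ℤ r) * z + f s) * inv (Z r * z ^ 2 - V r * z + 1#) D≉0
    horadam-sum {f} rec r s k z D≉0 = x*y≈z⇒x≈z*y⁻¹ (begin
      sumTo k (λ j → a (+ j) * z ^ j) * (Z r * z ^ 2 - V r * z + 1#)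
        ≈⟨ generating-sum (recurrent-subsequence rec r s) k z ⟩
      Z r * a (+ k) * z ^ suc (suc k) - a (+ suc k) * z ^ suc k - Z r * a -[1+ 0 ] * z + a (+ 0)
        ≈⟨ +-cong (+-cong (+-cong (*-congˡ (reflexive (cong (z ^_) (ℕ.+-comm 2 k))))
                                  (-‿cong (*-congʳ (reflexive (cong f (r*suc[k]+s≡r*k+r+s r s (+ k)))))))
                          (-‿cong (*-congʳ (*-congˡ (reflexive (cong f (r*[-1]+s≡s-r r s)))))))
                  (reflexive (cong f (r*0+s≡s r s))) ⟩
      Z r * a (+ k) * z ^ (k +ℕ 2) - f (r *ℤ + k +ℤ r +ℤ s) * z ^ suc k - Z r * f (s -ℤ r) * z + f s ∎) D≉0
      where
      a : ℤ → Carrier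
      a j = f (r *ℤ j +ℤ s)
      r*suc[k]+s≡r*k+r+s : ∀ r s k → r *ℤ (+ 1 +ℤ k) +ℤ s ≡ r *ℤ k +ℤ r +ℤ s
      r*suc[k]+s≡r*k+r+s = solve-∀
      r*[-1]+s≡s-r : ∀ r s → r *ℤ (ℤ.- + 1) +ℤ s ≡ s -ℤ r
      r*[-1]+s≡s-r = solve-∀
      r*0+s≡s : ∀ r s → r *ℤ + 0 +ℤ s ≡ s
      r*0+s≡s = solve-∀

theorem1 : ∀ {c ℓ : Level} (F : Field c ℓ) →
    let open Field F in
    let open FieldOps F in
    (a b p q : Carrier) → ¬ (p ≈ 0#) → (q≉0 : ¬ (q ≈ 0#)) →
    ¬ ((p * p - (1# + 1# + 1# + 1#) * q) ≈ 0#) →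
    (r s : ℤ) (k : ℕ) (z : Carrier) →
    (D≉0 : ¬ ((zpow q q≉0 r * (z ^ 2) - lucasV p q q≉0 r * z + 1#) ≈ 0#)) →
    let u = lucasU p q q≉0 in
    let v = lucasV p q q≉0 in
    let w = horadam a b p q q≉0 in
    let qz = zpow q q≉0 in
    let D⁻¹ = inv (qz r * (z ^ 2) - v r * z + 1#) D≉0 in
    let K = + k in
    (sumTo k (λ j → u (r *ℤ + j +ℤ s) * (z ^ j))
      ≈ (qz r * u (r *ℤ K +ℤ s) * (z ^ (k Data.Nat.+ 2))
          - u (r *ℤ K +ℤ r +ℤ s) * (z ^ suc k)
          + qz s * u (r -ℤ s) * z + u s) * D⁻¹)
    × (sumTo k (λ j → v (r *ℤ + j +ℤ s) * (z ^ j))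
      ≈ (qz r * v (r *ℤ K +ℤ s) * (z ^ (k Data.Nat.+ 2))
          - v (r *ℤ K +ℤ r +ℤ s) * (z ^ suc k)
          - qz s * v (r -ℤ s) * z + v s) * D⁻¹)
    × (sumTo k (λ j → w (r *ℤ + j +ℤ s) * (z ^ j))
      ≈ (qz r * w (r *ℤ K +ℤ s) * (z ^ (k Data.Nat.+ 2))
          - w (r *ℤ K +ℤ r +ℤ s) * (z ^ suc k)
          - qz r * w (s -ℤ r) * z + w s) * D⁻¹)
theorem1 F a b p q _ q≉0 _ r s k z D≉0 =
  trans (horadam-sum lucasU-recurrent r s k z D≉0)
        (*-congʳ (+-congʳ (+-congˡ (trans (-‿distribˡ-* _ _) (*-congʳ (sym (lucasU-reflection r s))))))) ,
  trans (horadam-sum lucasV-recurrent r s k z D≉0)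
        (*-congʳ (+-congʳ (+-congˡ (-‿cong (*-congʳ (sym (lucasV-reflection r s))))))) ,
  horadam-sum (horadam-recurrent a b) r s k z D≉0
  where
  open Field F
  open import Algebra.Properties.Ring ring using (-‿distribˡ-*)
  open LinearRecurrences.Recurrence F p q q≉0
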